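{- For $n \geq 1$, the number of $i$-sets of the path $P_n$ (the order of $\mathscr{I}(P_n)$) is \[ |V(\mathscr{I}(P_n))| = \begin{cases} 1 & \text{if } n = 3k,\\ \binom{k+2}{k} & \text{if } n = 3k+1,\\ k+2 & \text{if } n = 3k+2, \end{cases} \] where $k \ge 0$ is an integer.
   Context: For a graph $G$, $i(G)$ is the minimum size of an independent dominating set, and an $i$-set of $G$ is an independent dominating set of size $i(G)$. $\mathscr{I}(G)$ denotes the $i$-graph of $G$, whose vertex set is the set of $i$-sets of $G$. $P_n$ is the path on $n$ vertices. -}

module Defs where

open import Data.Nat using (ℕ; suc; _+_; _≤_)
open import Data.Fin using (Fin; toℕ)
open import Data.Fin.Subset using (Subset; _∈_; ∣_∣)
open import Data.Product using (Σ; ∃; _×_)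
open import Data.Sum using (_⊎_)
open import Data.List using (List; length)
open import Data.List.Relation.Unary.Unique.Propositional using (Unique)
import Data.List.Membership.Propositional as LM
open import Function.Bundles using (_⇔_)
open import Relation.Binary.PropositionalEquality using (_≡_)
open import Relation.Nullary using (¬_)

PathAdj : (n : ℕ) → Fin n → Fin n → Set
PathAdj n i j = (suc (toℕ i) ≡ toℕ j) ⊎ (suc (toℕ j) ≡ toℕ i)

Independent : (n : ℕ) → Subset n → Set
Independent n S = ∀ i j → i ∈ S → j ∈ S → ¬ PathAdj n i j

Dominating : (n : ℕ) → Subset n → Set
Dominating n S = ∀ v → (v ∈ S) ⊎ (∃ λ u → (u ∈ S) × PathAdj n u v)

IndependentDominating : (n : ℕ) → Subset n → Set
IndependentDominating n S = Independent n S × Dominating n S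

ISet : (n : ℕ) → Subset n → Set
ISet n S = IndependentDominating n S
         × (∀ T → IndependentDominating n T → ∣ S ∣ ≤ ∣ T ∣)

HasExactly : {A : Set} → (A → Set) → ℕ → Set
HasExactly {A} P m = Σ (List A) λ L → Unique L × (length L ≡ m) × (∀ x → (x LM.∈ L) ⇔ P x)

-- Read a subset S of P_n from left to right. Whether S is independent dominating is a local
-- condition, checked by a three-state automaton remembering whether the previous vertex is in S,
-- outside S but dominated, or outside S and undominated. A member of S dominates at most three
-- vertices, so 3|S| = n + w where the waste w ≥ 0 counts the closed-neighbourhood slots of members
-- that fall off the path or onto an already dominated vertex; the automaton can keep track of w.
-- Hence the i-sets are exactly the accepted sets of waste r, the unique r ≤ 2 with r ≡ -n (mod 3).
-- Counting them gives a(n+3, 0) = a(n, 0) and a(n+3, w+1) = a(n+1, w) + a(n, w+1), which for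
-- n = 3k, 3k+2, 3k+1 are solved by 1, k + 2 and Pascal's rule.
module Submission where

open import Defs
open import Data.Nat using (ℕ; zero; suc; _+_; _*_; _∸_; _≤_; z≤n; s≤s)
open import Data.Nat.Properties
open import Data.Nat.Combinatorics using (_C_; nCk≡nC[n∸k]; nC1≡n; nCk+nC[k+1]≡[n+1]C[k+1])
open import Data.Bool using (Bool; true; false)
open import Data.Bool.Properties using (not-¬; ¬-not)
open import Data.Fin using (Fin; zero; suc; toℕ)
open import Data.Fin.Subset using (Subset; _∈_; ∣_∣)
open import Data.Vec using ([]; _∷_; here; there)
open import Data.Vec.Properties using (∷-injectiveʳ)
open import Data.List using (List; []; _∷_; [_]; length; map; _++_)
open import Data.List.Properties using (length-map; length-++)
open import Data.List.Membership.Propositional using () renaming (_∈_ to _∈ₗ_)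
open import Data.List.Membership.Propositional.Properties using (∈-map⁺; ∈-map⁻; ∈-++⁺ˡ; ∈-++⁺ʳ; ∈-++⁻)
open import Data.List.Relation.Unary.Any using (here)
open import Data.List.Relation.Unary.Unique.Propositional using (Unique)
open import Data.List.Relation.Unary.AllPairs using ([]; _∷_)
open import Data.List.Relation.Unary.All using ([])
import Data.List.Relation.Unary.Unique.Propositional.Properties as Unique
open import Data.Product as Product using (∃; _×_; _,_)
open import Data.Sum as Sum using (_⊎_; inj₁; inj₂)
open import Data.Empty using (⊥)
open import Data.Unit using (⊤; tt)
open import Function using (_∘_; id)
open import Function.Bundles using (_⇔_; mk⇔; Equivalence)
open import Relation.Binary.PropositionalEquality using (_≡_; refl; sym; trans; cong; cong₂; subst; module ≡-Reasoning)
open import Relation.Nullary using (¬_)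

first : ∀ {n} → Subset n → Bool
first []      = false
first (b ∷ _) = b

first-∈ : ∀ {n} (S : Subset n) (i : Fin n) → toℕ i ≡ 0 → i ∈ S → first S ≡ true
first-∈ (b ∷ S) zero _ here = refl

first⇒∈ : ∀ {n} (S : Subset n) → first S ≡ true → ∃ λ i → toℕ i ≡ 0 × i ∈ S
first⇒∈ (true ∷ S) refl = zero , refl , here

PathAdj-suc⁺ : ∀ {n} {i j : Fin n} → PathAdj n i j → PathAdj (suc n) (suc i) (suc j)
PathAdj-suc⁺ = Sum.map (cong suc) (cong suc)

PathAdj-suc⁻ : ∀ {n} {i j : Fin n} → PathAdj (suc n) (suc i) (suc j) → PathAdj n i j
PathAdj-suc⁻ = Sum.map suc-injective suc-injective

-- In both definitions p tells whether a virtual vertex placed just before the path lies in S.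
DominatingAfter : (n : ℕ) → Bool → Subset n → Set
DominatingAfter n p S = ∀ v → v ∈ S ⊎ (∃ λ u → u ∈ S × PathAdj n u v) ⊎ (p ≡ true × toℕ v ≡ 0)

LocallyIDS : ∀ {n} → Bool → Subset n → Set
LocallyIDS p []      = ⊤
LocallyIDS p (b ∷ S) = (b ≡ true → first S ≡ true → ⊥)
                     × (b ≡ true ⊎ p ≡ true ⊎ first S ≡ true)
                     × LocallyIDS b S

independent⇒dominatingAfter⇒locallyIDS : ∀ {n} p (S : Subset n) → Independent n S → DominatingAfter n p S → LocallyIDS p S
independent⇒dominatingAfter⇒locallyIDS p []      ind dom = tt
independent⇒dominatingAfter⇒locallyIDS p (b ∷ S) ind dom =
  noEdge , dominated , independent⇒dominatingAfter⇒locallyIDS b S ind′ dom′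
  where
  noEdge : b ≡ true → first S ≡ true → ⊥
  noEdge refl first≡true with first⇒∈ S first≡true
  ... | i , i≡0 , i∈S = ind zero (suc i) here (there i∈S) (inj₁ (cong suc (sym i≡0)))

  dominated : b ≡ true ⊎ p ≡ true ⊎ first S ≡ true
  dominated with dom zero
  ... | inj₁ here                                = inj₁ refl
  ... | inj₂ (inj₂ (p≡true , _))                 = inj₂ (inj₁ p≡true)
  ... | inj₂ (inj₁ (zero , _ , inj₁ ()))
  ... | inj₂ (inj₁ (zero , _ , inj₂ ()))
  ... | inj₂ (inj₁ (suc u , there u∈S , inj₂ e)) = inj₂ (inj₂ (first-∈ S u (sym (suc-injective e)) u∈S))

  ind′ : Independent _ S
  ind′ i j i∈S j∈S adj = ind (suc i) (suc j) (there i∈S) (there j∈S) (PathAdj-suc⁺ adj)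

  dom′ : DominatingAfter _ b S
  dom′ v with dom (suc v)
  ... | inj₁ (there v∈S)                          = inj₁ v∈S
  ... | inj₂ (inj₁ (suc u , there u∈S , adj))     = inj₂ (inj₁ (u , u∈S , PathAdj-suc⁻ adj))
  ... | inj₂ (inj₁ (zero , here , inj₁ e))        = inj₂ (inj₂ (refl , sym (suc-injective e)))

locallyIDS⇒independent : ∀ {n p} (S : Subset n) → LocallyIDS p S → Independent n S
locallyIDS⇒independent (b ∷ S) (noEdge , _ , _) zero (suc j) here (there j∈S) (inj₁ e) =
  noEdge refl (first-∈ S j (sym (suc-injective e)) j∈S)
locallyIDS⇒independent (b ∷ S) (noEdge , _ , _) (suc i) zero (there i∈S) here (inj₂ e) =
  noEdge refl (first-∈ S i (sym (suc-injective e)) i∈S)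
locallyIDS⇒independent (b ∷ S) (_ , _ , loc) (suc i) (suc j) (there i∈S) (there j∈S) adj =
  locallyIDS⇒independent S loc i j i∈S j∈S (PathAdj-suc⁻ adj)

locallyIDS⇒dominatingAfter : ∀ {n} p (S : Subset n) → LocallyIDS p S → DominatingAfter n p S
locallyIDS⇒dominatingAfter p (b ∷ S) (_ , inj₁ refl , _) zero = inj₁ here
locallyIDS⇒dominatingAfter p (b ∷ S) (_ , inj₂ (inj₁ p≡true) , _) zero = inj₂ (inj₂ (p≡true , refl))
locallyIDS⇒dominatingAfter p (b ∷ S) (_ , inj₂ (inj₂ first≡true) , _) zero with first⇒∈ S first≡true
... | i , i≡0 , i∈S = inj₂ (inj₁ (suc i , there i∈S , inj₂ (cong suc (sym i≡0))))
locallyIDS⇒dominatingAfter p (b ∷ S) (_ , _ , loc) (suc v) with locallyIDS⇒dominatingAfter b S loc v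
... | inj₁ v∈S                   = inj₁ (there v∈S)
... | inj₂ (inj₁ (u , u∈S , adj)) = inj₂ (inj₁ (suc u , there u∈S , PathAdj-suc⁺ adj))
... | inj₂ (inj₂ (refl , v≡0))    = inj₂ (inj₁ (zero , here , inj₁ (cong suc (sym v≡0))))

independentDominating⇒locallyIDS : ∀ {n} (S : Subset n) → IndependentDominating n S → LocallyIDS false S
independentDominating⇒locallyIDS S (ind , dom) =
  independent⇒dominatingAfter⇒locallyIDS false S ind (Sum.map₂ inj₁ ∘ dom)

locallyIDS⇒independentDominating : ∀ {n} (S : Subset n) → LocallyIDS false S → IndependentDominating n S
locallyIDS⇒independentDominating S loc =
  locallyIDS⇒independent S loc ,
  Sum.map₂ (Sum.fromInj₁ λ { (() , _) }) ∘ locallyIDS⇒dominatingAfter false S loc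

-- free: the previous vertex is outside S and dominated, or does not exist;
-- blocked: the previous vertex is in S; forced: it is outside S and undominated.
data State : Set where
  free blocked forced : State

-- `Accepts s S w`: S is read successfully from state s with waste w; a member read in state free
-- wastes its left slot, and a member at the end of the path its right slot.
Accepts : ∀ {n} → State → Subset n → ℕ → Set
Accepts free    []          w       = w ≡ 0
Accepts blocked []          w       = w ≡ 1
Accepts forced  []          w       = ⊥
Accepts free    (false ∷ S) w       = Accepts forced S w
Accepts free    (true  ∷ S) zero    = ⊥
Accepts free    (true  ∷ S) (suc w) = Accepts blocked S w
Accepts blocked (false ∷ S) w       = Accepts free S w
Accepts blocked (true  ∷ S) w       = ⊥
Accepts forced  (false ∷ S) w       = ⊥
Accepts forced  (true  ∷ S) w       = Accepts blocked S w

Admissible : ∀ {n} → State → Subset n → Set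
Admissible free    S = LocallyIDS false S
Admissible blocked S = first S ≡ false × LocallyIDS true S
Admissible forced  S = first S ≡ true × LocallyIDS false S

accepts⇒admissible : ∀ {n} s (S : Subset n) w → Accepts s S w → Admissible s S
accepts⇒admissible free    []          _       _   = tt
accepts⇒admissible blocked []          _       _   = refl , tt
accepts⇒admissible free    (false ∷ S) w       acc with accepts⇒admissible forced S w acc
... | first≡true , loc = (λ ()) , inj₂ (inj₂ first≡true) , loc
accepts⇒admissible free    (true ∷ S)  (suc w) acc with accepts⇒admissible blocked S w acc
... | first≡false , loc = (λ _ → not-¬ first≡false) , inj₁ refl , loc
accepts⇒admissible blocked (false ∷ S) w       acc =
  refl , (λ ()) , inj₂ (inj₁ refl) , accepts⇒admissible free S w acc
accepts⇒admissible forced  (true ∷ S)  w       acc with accepts⇒admissible blocked S w acc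
... | first≡false , loc = refl , (λ _ → not-¬ first≡false) , inj₁ refl , loc

admissible⇒accepts : ∀ {n} s (S : Subset n) → Admissible s S → ∃ (Accepts s S)
admissible⇒accepts free    []          _ = 0 , refl
admissible⇒accepts blocked []          _ = 1 , refl
admissible⇒accepts free    (true ∷ S)  (noEdge , _ , loc) =
  Product.map suc id (admissible⇒accepts blocked S (¬-not (noEdge refl) , loc))
admissible⇒accepts free    (false ∷ S) (_ , inj₂ (inj₂ first≡true) , loc) =
  admissible⇒accepts forced S (first≡true , loc)
admissible⇒accepts blocked (false ∷ S) (_ , _ , _ , loc) = admissible⇒accepts free S loc
admissible⇒accepts forced  (true ∷ S)  (_ , noEdge , _ , loc) =
  admissible⇒accepts blocked S (¬-not (noEdge refl) , loc)

independentDominating⇒accepts : ∀ {n} (S : Subset n) → IndependentDominating n S → ∃ (Accepts free S)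
independentDominating⇒accepts S = admissible⇒accepts free S ∘ independentDominating⇒locallyIDS S

accepts⇒independentDominating : ∀ {n} (S : Subset n) {w} → Accepts free S w → IndependentDominating n S
accepts⇒independentDominating S {w} = locallyIDS⇒independentDominating S ∘ accepts⇒admissible free S w

Balance : State → (size n w : ℕ) → Set
Balance free    size n w = 3 * size ≡ n + w
Balance blocked size n w = suc (3 * size) ≡ n + w
Balance forced  size n w = 3 * size ≡ suc (n + w)

accepts⇒balance : ∀ {n} s (S : Subset n) w → Accepts s S w → Balance s ∣ S ∣ n w
accepts⇒balance           free    []          _       refl = refl
accepts⇒balance           blocked []          _       refl = refl
accepts⇒balance {suc n}   free    (false ∷ S) w       acc  = accepts⇒balance forced S w acc
accepts⇒balance {suc n}   free    (true ∷ S)  (suc w) acc  = begin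
  3 * suc ∣ S ∣       ≡⟨ *-suc 3 ∣ S ∣ ⟩
  2 + suc (3 * ∣ S ∣) ≡⟨ cong (2 +_) (accepts⇒balance blocked S w acc) ⟩
  2 + (n + w)         ≡⟨ cong suc (+-suc n w) ⟨
  suc n + suc w       ∎
  where open ≡-Reasoning
accepts⇒balance {suc n}   blocked (false ∷ S) w       acc  = cong suc (accepts⇒balance free S w acc)
accepts⇒balance {suc n}   forced  (true ∷ S)  w       acc  =
  trans (*-suc 3 ∣ S ∣) (cong (2 +_) (accepts⇒balance blocked S w acc))

waste≤2⇒minimal : ∀ {n r w s t} → r ≤ 2 → 3 * s ≡ n + r → 3 * t ≡ n + w → s ≤ t
waste≤2⇒minimal {n} {r} {w} {s} {t} r≤2 3s≡n+r 3t≡n+w =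
  m<1+n⇒m≤n (*-cancelˡ-< 3 s (suc t) (begin-strict
    3 * s      ≡⟨ 3s≡n+r ⟩
    n + r      ≤⟨ +-monoʳ-≤ n r≤2 ⟩
    n + 2      <⟨ +-monoʳ-< n (n<1+n 2) ⟩
    n + 3      ≤⟨ +-monoˡ-≤ 3 (m≤m+n n w) ⟩
    n + w + 3  ≡⟨ cong (_+ 3) 3t≡n+w ⟨
    3 * t + 3  ≡⟨ +-comm (3 * t) 3 ⟩
    3 + 3 * t  ≡⟨ *-suc 3 t ⟨
    3 * suc t  ∎))
  where open ≤-Reasoning

minimal⇒waste≡ : ∀ {n r w s t} → r ≤ 2 → 3 * s ≡ n + w → 3 * t ≡ n + r → s ≤ t → w ≡ r
minimal⇒waste≡ {n} {r} {w} {s} {t} r≤2 3s≡n+w 3t≡n+r s≤t = +-cancelˡ-≡ n w r (begin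
  n + w  ≡⟨ 3s≡n+w ⟨
  3 * s  ≡⟨ cong (3 *_) (≤-antisym s≤t (waste≤2⇒minimal r≤2 3t≡n+r 3s≡n+w)) ⟩
  3 * t  ≡⟨ 3t≡n+r ⟩
  n + r  ∎)
  where open ≡-Reasoning

iSet⇔accepts : ∀ {n r} {W : Subset n} → r ≤ 2 → Accepts free W r → (S : Subset n) → ISet n S ⇔ Accepts free S r
iSet⇔accepts {n} {r} {W} r≤2 W-acc S = mk⇔ to from
  where
  to : ISet n S → Accepts free S r
  to (S-ids , S-min) with independentDominating⇒accepts S S-ids
  ... | w , S-acc = subst (Accepts free S)
    (minimal⇒waste≡ r≤2 (accepts⇒balance free S w S-acc) (accepts⇒balance free W r W-acc)
                        (S-min W (accepts⇒independentDominating W W-acc)))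
    S-acc

  from : Accepts free S r → ISet n S
  from S-acc = accepts⇒independentDominating S S-acc , S-min
    where
    S-min : ∀ T → IndependentDominating n T → ∣ S ∣ ≤ ∣ T ∣
    S-min T T-ids with independentDominating⇒accepts T T-ids
    ... | w , T-acc = waste≤2⇒minimal r≤2 (accepts⇒balance free S r S-acc) (accepts⇒balance free T w T-acc)

accepted : State → (n : ℕ) → ℕ → List (Subset n)
accepted free    zero    zero          = [ [] ]
accepted free    zero    (suc w)       = []
accepted blocked zero    zero          = []
accepted blocked zero    (suc zero)    = [ [] ]
accepted blocked zero    (suc (suc w)) = []
accepted forced  zero    w             = []
accepted free    (suc n) zero          = map (false ∷_) (accepted forced n zero)
accepted free    (suc n) (suc w)       = map (true ∷_) (accepted blocked n w) ++ map (false ∷_) (accepted forced n (suc w))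
accepted blocked (suc n) w             = map (false ∷_) (accepted free n w)
accepted forced  (suc n) w             = map (true ∷_) (accepted blocked n w)

#accepted : State → ℕ → ℕ → ℕ
#accepted free    zero    zero          = 1
#accepted free    zero    (suc w)       = 0
#accepted blocked zero    zero          = 0
#accepted blocked zero    (suc zero)    = 1
#accepted blocked zero    (suc (suc w)) = 0
#accepted forced  zero    w             = 0
#accepted free    (suc n) zero          = #accepted forced n zero
#accepted free    (suc n) (suc w)       = #accepted blocked n w + #accepted forced n (suc w)
#accepted blocked (suc n) w             = #accepted free n w
#accepted forced  (suc n) w             = #accepted blocked n w

length-accepted : ∀ s n w → length (accepted s n w) ≡ #accepted s n w
length-accepted free    zero    zero          = refl
length-accepted free    zero    (suc w)       = refl
length-accepted blocked zero    zero          = refl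
length-accepted blocked zero    (suc zero)    = refl
length-accepted blocked zero    (suc (suc w)) = refl
length-accepted forced  zero    w             = refl
length-accepted free    (suc n) zero          =
  trans (length-map _ (accepted forced n zero)) (length-accepted forced n zero)
length-accepted free    (suc n) (suc w)       = begin
  length (map (true ∷_) (accepted blocked n w) ++ map (false ∷_) (accepted forced n (suc w)))
    ≡⟨ length-++ (map (true ∷_) (accepted blocked n w)) ⟩
  length (map (true ∷_) (accepted blocked n w)) + length (map (false ∷_) (accepted forced n (suc w)))
    ≡⟨ cong₂ _+_ (length-map _ (accepted blocked n w)) (length-map _ (accepted forced n (suc w))) ⟩
  length (accepted blocked n w) + length (accepted forced n (suc w))
    ≡⟨ cong₂ _+_ (length-accepted blocked n w) (length-accepted forced n (suc w)) ⟩
  #accepted blocked n w + #accepted forced n (suc w)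
    ∎
  where open ≡-Reasoning
length-accepted blocked (suc n) w =
  trans (length-map _ (accepted free n w)) (length-accepted free n w)
length-accepted forced  (suc n) w =
  trans (length-map _ (accepted blocked n w)) (length-accepted blocked n w)

∈-accepted⁻ : ∀ s n w {S : Subset n} → S ∈ₗ accepted s n w → Accepts s S w
∈-accepted⁻ free    zero    zero       (here refl) = refl
∈-accepted⁻ blocked zero    (suc zero) (here refl) = refl
∈-accepted⁻ free    (suc n) zero       S∈ with ∈-map⁻ _ S∈
... | _ , S∈′ , refl = ∈-accepted⁻ forced n zero S∈′
∈-accepted⁻ free    (suc n) (suc w)    S∈ with ∈-++⁻ (map (true ∷_) (accepted blocked n w)) S∈
... | inj₁ S∈ˡ with ∈-map⁻ _ S∈ˡ
...   | _ , S∈′ , refl = ∈-accepted⁻ blocked n w S∈′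
∈-accepted⁻ free    (suc n) (suc w)    S∈ | inj₂ S∈ʳ with ∈-map⁻ _ S∈ʳ
...   | _ , S∈′ , refl = ∈-accepted⁻ forced n (suc w) S∈′
∈-accepted⁻ blocked (suc n) w          S∈ with ∈-map⁻ _ S∈
... | _ , S∈′ , refl = ∈-accepted⁻ free n w S∈′
∈-accepted⁻ forced  (suc n) w          S∈ with ∈-map⁻ _ S∈
... | _ , S∈′ , refl = ∈-accepted⁻ blocked n w S∈′

∈-accepted⁺ : ∀ s n w {S : Subset n} → Accepts s S w → S ∈ₗ accepted s n w
∈-accepted⁺ free    zero    zero    {[]}        refl = here refl
∈-accepted⁺ blocked zero    _       {[]}        refl = here refl
∈-accepted⁺ free    (suc n) zero    {false ∷ S} acc  = ∈-map⁺ (false ∷_) (∈-accepted⁺ forced n zero acc)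
∈-accepted⁺ free    (suc n) (suc w) {true ∷ S}  acc  = ∈-++⁺ˡ (∈-map⁺ (true ∷_) (∈-accepted⁺ blocked n w acc))
∈-accepted⁺ free    (suc n) (suc w) {false ∷ S} acc  =
  ∈-++⁺ʳ (map (true ∷_) (accepted blocked n w)) (∈-map⁺ (false ∷_) (∈-accepted⁺ forced n (suc w) acc))
∈-accepted⁺ blocked (suc n) w       {false ∷ S} acc  = ∈-map⁺ (false ∷_) (∈-accepted⁺ free n w acc)
∈-accepted⁺ forced  (suc n) w       {true ∷ S}  acc  = ∈-map⁺ (true ∷_) (∈-accepted⁺ blocked n w acc)

accepted-unique : ∀ s n w → Unique (accepted s n w)
accepted-unique free    zero    zero          = [] ∷ []
accepted-unique free    zero    (suc w)       = []
accepted-unique blocked zero    zero          = []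
accepted-unique blocked zero    (suc zero)    = [] ∷ []
accepted-unique blocked zero    (suc (suc w)) = []
accepted-unique forced  zero    w             = []
accepted-unique free    (suc n) zero          = Unique.map⁺ ∷-injectiveʳ (accepted-unique forced n zero)
accepted-unique free    (suc n) (suc w)       =
  Unique.++⁺ (Unique.map⁺ ∷-injectiveʳ (accepted-unique blocked n w))
             (Unique.map⁺ ∷-injectiveʳ (accepted-unique forced n (suc w)))
             disjoint
  where
  disjoint : ∀ {S} → ¬ (S ∈ₗ map (true ∷_) (accepted blocked n w) × S ∈ₗ map (false ∷_) (accepted forced n (suc w)))
  disjoint (S∈ˡ , S∈ʳ) with ∈-map⁻ _ S∈ˡ | ∈-map⁻ _ S∈ʳ
  ... | _ , _ , refl | _ , _ , ()
accepted-unique blocked (suc n) w             = Unique.map⁺ ∷-injectiveʳ (accepted-unique free n w)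
accepted-unique forced  (suc n) w             = Unique.map⁺ ∷-injectiveʳ (accepted-unique blocked n w)

iSets-exactly : ∀ n r {m} → r ≤ 2 → #accepted free n r ≡ m → 1 ≤ m → HasExactly (ISet n) m
iSets-exactly n r r≤2 #≡m 1≤m =
  accepted free n r , accepted-unique free n r , length≡m ,
  λ S → mk⇔ (Equivalence.from (iSet⇔ S) ∘ ∈-accepted⁻ free n r) (∈-accepted⁺ free n r ∘ Equivalence.to (iSet⇔ S))
  where
  length≡m = trans (length-accepted free n r) #≡m

  witness : (Ss : List (Subset n)) → 1 ≤ length Ss → ∃ (_∈ₗ Ss)
  witness (S ∷ _) _ = S , here refl

  iSet⇔ : ∀ S → ISet n S ⇔ Accepts free S r
  iSet⇔ with witness (accepted free n r) (subst (1 ≤_) (sym length≡m) 1≤m)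
  ... | W , W∈ = iSet⇔accepts {W = W} r≤2 (∈-accepted⁻ free n r W∈)

#accepted-free-step₀ : ∀ n → #accepted free (3 + n) 0 ≡ #accepted free n 0
#accepted-free-step₀ n = refl

#accepted-free-step : ∀ n w → #accepted free (3 + n) (suc w) ≡ #accepted free (1 + n) w + #accepted free n (suc w)
#accepted-free-step n w = refl

#accepted-3k : ∀ k → #accepted free (k * 3) 0 ≡ 1
#accepted-3k zero    = refl
#accepted-3k (suc k) = trans (#accepted-free-step₀ (k * 3)) (#accepted-3k k)

#accepted-3k+2 : ∀ k → #accepted free (2 + k * 3) 1 ≡ k + 2
#accepted-3k+2 zero    = refl
#accepted-3k+2 (suc k) =
  trans (#accepted-free-step (2 + k * 3) 0) (cong₂ _+_ (#accepted-3k (suc k)) (#accepted-3k+2 k))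

[1+n]Cn≡1+n : ∀ n → suc n C n ≡ suc n
[1+n]Cn≡1+n n = begin
  suc n C n              ≡⟨ nCk≡nC[n∸k] (n≤1+n n) ⟩
  suc n C (1 + n ∸ n)    ≡⟨ cong (suc n C_) (m+n∸n≡m 1 n) ⟩
  suc n C 1              ≡⟨ nC1≡n (suc n) ⟩
  suc n                  ∎
  where open ≡-Reasoning

pascal-[k+3]C[k+1] : ∀ k → suc (k + 2) C suc k ≡ (k + 2) C k + (k + 2)
pascal-[k+3]C[k+1] k = begin
  suc (k + 2) C suc k            ≡⟨ nCk+nC[k+1]≡[n+1]C[k+1] (k + 2) k ⟨
  (k + 2) C k + (k + 2) C suc k  ≡⟨ cong (λ n → (k + 2) C k + n C suc k) (+-comm k 2) ⟩
  (k + 2) C k + (2 + k) C suc k  ≡⟨ cong ((k + 2) C k +_) ([1+n]Cn≡1+n (suc k)) ⟩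
  (k + 2) C k + (2 + k)          ≡⟨ cong ((k + 2) C k +_) (+-comm 2 k) ⟩
  (k + 2) C k + (k + 2)          ∎
  where open ≡-Reasoning

[k+2]Ck-positive : ∀ k → 1 ≤ (k + 2) C k
[k+2]Ck-positive zero    = ≤-refl
[k+2]Ck-positive (suc k) =
  subst (1 ≤_) (sym (pascal-[k+3]C[k+1] k)) (≤-trans ([k+2]Ck-positive k) (m≤m+n _ (k + 2)))

#accepted-3k+1 : ∀ k → #accepted free (1 + k * 3) 2 ≡ (k + 2) C k
#accepted-3k+1 zero    = refl
#accepted-3k+1 (suc k) = begin
  #accepted free (3 + (1 + k * 3)) 2  ≡⟨ #accepted-free-step (1 + k * 3) 1 ⟩
  #accepted free (2 + k * 3) 1 + #accepted free (1 + k * 3) 2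
    ≡⟨ cong₂ _+_ (#accepted-3k+2 k) (#accepted-3k+1 k) ⟩
  (k + 2) + (k + 2) C k               ≡⟨ +-comm (k + 2) _ ⟩
  (k + 2) C k + (k + 2)               ≡⟨ pascal-[k+3]C[k+1] k ⟨
  suc (k + 2) C suc k                 ∎
  where open ≡-Reasoning

mainTheorem6 : (∀ k → 1 ≤ k → HasExactly (ISet (3 * k)) 1)
    × (∀ k → HasExactly (ISet (3 * k + 1)) ((k + 2) C k))
    × (∀ k → HasExactly (ISet (3 * k + 2)) (k + 2))
mainTheorem6 =
  (λ k _ → reindex (*-comm 3 k) (iSets-exactly (k * 3) 0 z≤n (#accepted-3k k) ≤-refl)) ,
  (λ k → reindex (3k+r≡r+k3 k 1)
           (iSets-exactly (1 + k * 3) 2 ≤-refl (#accepted-3k+1 k) ([k+2]Ck-positive k))) ,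
  (λ k → reindex (3k+r≡r+k3 k 2)
           (iSets-exactly (2 + k * 3) 1 (s≤s z≤n) (#accepted-3k+2 k) (<⇒≤ (m≤n+m 2 k))))
  where
  reindex : ∀ {n n′ m} → n ≡ n′ → HasExactly (ISet n′) m → HasExactly (ISet n) m
  reindex n≡n′ = subst (λ n → HasExactly (ISet n) _) (sym n≡n′)

  3k+r≡r+k3 : ∀ k r → 3 * k + r ≡ r + k * 3
  3k+r≡r+k3 k r = trans (+-comm (3 * k) r) (cong (r +_) (*-comm 3 k))
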